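{- Let $s$ and $t$ be odd integers. For every integer $n\ge0$, $$\nu_2(C_{\{n\}})=\begin{cases}\zeta_{\mathbf F}(n+1)+\nu_2(\{6\})-3 & \text{if } t\equiv1\pmod 4 \text{ and } n\equiv 3 \text{ or } 4\pmod 6,\\ \zeta_{\mathbf F}(n+1)-1 & \text{otherwise.}\end{cases}$$
   Context: For indeterminates $s,t$: $\{0\}=0$, $\{1\}=1$, $\{n\}=s\{n-1\}+t\{n-2\}$ ($n\ge2$); $\{n\}!=\{1\}\cdots\{n\}$; $\left\{ n\atop k\right\}=\frac{\{n\}!}{\{k\}!\{n-k\}!}$. The generalized Catalan number is $C_{\{n\}}=\frac{1}{\{n+1\}}\left\{ {2n}\atop n\right\}$, which is a polynomial in $s,t$ with nonnegative integer coefficients; for integer $s,t$ it denotes the value of this polynomial, and $\{6\}=s^5+4s^3t+3st^2$ is likewise evaluated. $\nu_2$ is the $2$-adic valuation ($\nu_2(0)=\infty$). The base $\mathbf F=(1,3,6,12,24,\dots)$, i.e. $b_0=1$, $b_i=3\cdot2^{i-1}$ for $i\ge1$: every nonnegative integer $m$ has a unique expansion $m=\sum_{i\ge0}m_ib_i$ with $0\le m_i<b_{i+1}/b_i$ (so $m_0\in\{0,1,2\}$ and $m_i\in\{0,1\}$ for $i\ge1$), and $\zeta_{\mathbf F}(m)$ is the number of nonzero digits $m_i$ in this expansion. -}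

module Defs where

open import Data.Nat as ℕ using (ℕ; zero; suc)
open import Data.Nat.DivMod using (_%_; _/_)
open import Data.Integer as ℤ using (ℤ; +_)
open import Data.Product using (_×_; _,_)
open import Data.List using (List; []; _∷_; map; concatMap; _++_)
open import Data.Bool using (Bool; true; false; if_then_else_; _∧_)
open import Relation.Binary.PropositionalEquality using (_≡_)

-- Polynomials in ℤ[s,t], as finite lists of terms (c , i , j) = c s^i t^j.
-- Two term lists denote the same polynomial iff all coefficients agree.

Term : Set
Term = ℤ × ℕ × ℕ

Poly : Set
Poly = List Term

pconst : ℤ → Poly
pconst c = (c , 0 , 0) ∷ []

_⊕_ : Poly → Poly → Poly
P ⊕ Q = P ++ Q

mulT : Term → Term → Term
mulT (c , i , j) (d , k , l) = (c ℤ.* d , i ℕ.+ k , j ℕ.+ l)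

_⊗_ : Poly → Poly → Poly
P ⊗ Q = concatMap (λ a → map (mulT a) Q) P

mulS : Poly → Poly
mulS = map (λ { (c , i , j) → (c , suc i , j) })

mulTv : Poly → Poly
mulTv = map (λ { (c , i , j) → (c , i , suc j) })

coeff : Poly → ℕ → ℕ → ℤ
coeff [] i j = + 0
coeff ((c , k , l) ∷ P) i j =
  if (k ℕ.≡ᵇ i) ∧ (l ℕ.≡ᵇ j) then c ℤ.+ coeff P i j else coeff P i j

_≈ₚ_ : Poly → Poly → Set
P ≈ₚ Q = ∀ i j → coeff P i j ≡ coeff Q i j

eval : Poly → ℤ → ℤ → ℤ
eval [] s t = + 0
eval ((c , i , j) ∷ P) s t = c ℤ.* (s ℤ.^ i) ℤ.* (t ℤ.^ j) ℤ.+ eval P s t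

luc : ℕ → Poly
luc 0 = []
luc 1 = pconst (+ 1)
luc (suc (suc n)) = mulS (luc (suc n)) ⊕ mulTv (luc n)

lucFact : ℕ → Poly
lucFact 0 = pconst (+ 1)
lucFact (suc n) = lucFact n ⊗ luc (suc n)

-- C is (a representation of) the generalized Catalan polynomial C_{n},
-- i.e. the polynomial with  {n+1} · {n}! · {n}! · C = {2n}!  in ℤ[s,t]
-- (equivalently C = {2n choose n}/{n+1}); ℤ[s,t] is a domain, so such C
-- is unique up to ≈ₚ.
IsCatalan : ℕ → Poly → Set
IsCatalan n C = (luc (suc n) ⊗ (lucFact n ⊗ (lucFact n ⊗ C))) ≈ₚ lucFact (2 ℕ.* n)

data ℤ∞ : Set where
  fin : ℤ → ℤ∞
  ∞   : ℤ∞

_+∞_ : ℤ∞ → ℤ∞ → ℤ∞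
fin a +∞ fin b = fin (a ℤ.+ b)
_ +∞ _ = ∞

-- number of factors 2 in a positive natural m; fuel f ≥ m suffices
v2aux : ℕ → ℕ → ℕ
v2aux zero m = 0
v2aux (suc f) zero = 0
v2aux (suc f) (suc m) with suc m % 2
... | zero = suc (v2aux f (suc m / 2))
... | suc _ = 0

ν₂ : ℤ → ℤ∞
ν₂ z with ℤ.∣ z ∣
... | zero = ∞
... | suc m = fin (+ v2aux (suc m) (suc m))

-- The base F = (1,3,6,12,24,…): b₀ = 1, bᵢ = 3·2^(i-1).
-- The unique expansion m = Σ mᵢ bᵢ with m₀ ∈ {0,1,2}, mᵢ ∈ {0,1} (i ≥ 1)
-- has m₀ = m mod 3 and mᵢ (i ≥ 1) the (i-1)-th binary digit of ⌊m/3⌋.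

bit : ℕ → ℕ → ℕ
bit zero k = k % 2
bit (suc i) k = bit i (k / 2)

digitF : ℕ → ℕ → ℕ
digitF zero m = m % 3
digitF (suc i) m = bit i (m / 3)

nz : ℕ → ℕ
nz zero = 0
nz (suc _) = 1

countNZ : ℕ → ℕ → ℕ
countNZ zero m = 0
countNZ (suc K) m = countNZ K m ℕ.+ nz (digitF K m)

-- ζ_F(m): all digits with index > m vanish (bᵢ > m), so K = m+1 suffices
ζF : ℕ → ℕ
ζF m = countNZ (suc m) m

module Submission where

-- Write U_k = {k}(s,t) and a = ν₂(s²+t), b = ν₂(s²+3t).  Since ν₂ is additive,
-- ν₂(C_n) = ν₂({2n}!) − 2ν₂({n}!) − ν₂(U_{n+1}), so only the ν₂(U_k) matter.  For odd s, t,
-- U_k is odd unless 3 ∣ k, and U_{3m} = U_3 · W_m with W the Lucas sequence of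
-- (s³+3st, t³) = (s(s²+3t), t³); hence ν₂(U_{3m}) = a for odd m and
-- ν₂(U_{6m}) = a + b + ν₂(m).  Summed over blocks of six consecutive factors, a cancels,
-- b survives exactly when n ≡ 3, 4 (mod 6), and the terms ν₂(m) add up, by the carry
-- identity ν₂(m+1) + s₂(m+1) = s₂(m) + 1, to the binary digit sum counted by ζ_F(n+1).
-- If t ≡ 1 (mod 4) then a = 1 and ν₂({6}) = ν₂(U_3 (s³+3st)) = 1 + b; if t ≡ 3 (mod 4)
-- then b = 1 and both formulas agree.  When s²+t or s²+3t vanishes, t is replaced by a
-- t′ ≡ t modulo a high power of 2, using C_n(s,t) ≡ C_n(s,t′) (mod t − t′); for
-- s²+3t = 0 and n ≡ 3, 4 (mod 6) this makes C_n(s,t) divisible by every power of 2.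

open import Defs
open import Data.Nat as ℕ using (ℕ; zero; suc; s≤s; z≤n; NonZero)
import Data.Nat.Properties as ℕP
open import Data.Nat.Induction using (<-rec)
open import Data.Nat.DivMod using (_%_; _/_)
import Data.Nat.DivMod as ℕD
open import Data.Nat.Divisibility using (divides-refl)
open import Data.Integer as ℤ using (ℤ; +_; -[1+_]; _-_; ∣_∣)
import Data.Integer.Properties as ℤP
import Data.Integer.DivMod as ℤD
open import Data.Integer.Divisibility using (_∣_; divides)
open import Data.Product using (Σ-syntax; ∃-syntax; _×_; _,_; proj₁; proj₂)
open import Data.Sum using (_⊎_; inj₁; inj₂)
open import Data.Empty using (⊥-elim)
open import Data.Unit using (tt)
open import Data.Bool using (true; false; if_then_else_; _∧_; T)
open import Relation.Nullary using (¬_; yes; no)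
open import Relation.Binary.PropositionalEquality
open import Function using (_∘_)
open import Data.List using (_∷_; []; _++_; map)
import Data.List.Relation.Unary.All as All
open All using (All)
import Data.Nat.Tactic.RingSolver as NatSolver
open import Algebra.Properties.CommutativeSemigroup ℤP.*-commutativeSemigroup
  using () renaming (interchange to *-interchange)


-- 2-adic valuation and binary digit sums of naturals
module _ where
  open import Data.Nat using (_+_; _*_; _^_; _≤_; _<_)

  [r+kd]%d≡r : ∀ {d} .{{_ : NonZero d}} r k → r < d → (r + k * d) % d ≡ r
  [r+kd]%d≡r {d} r k r<d = trans (ℕD.[m+kn]%n≡m%n r k d) (ℕD.m<n⇒m%n≡m r<d)

  [r+kd]/d≡k : ∀ {d} .{{_ : NonZero d}} r k → r < d → (r + k * d) / d ≡ k
  [r+kd]/d≡k {d} r k r<d =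
    trans (ℕD.+-distrib-/-∣ʳ r (divides-refl k)) (cong₂ _+_ (ℕD.m<n⇒m/n≡0 r<d) (ℕD.m*n/n≡m k d))

  m≤1+n⇒m/2≤n : ∀ {m n} → m ≤ suc n → m / 2 ≤ n
  m≤1+n⇒m/2≤n {zero}  _       = z≤n
  m≤1+n⇒m/2≤n {suc m} m≤1+n = ℕP.≤-pred (ℕP.<-≤-trans (ℕD.m/n<m (suc m) 2 (s≤s (s≤s z≤n))) m≤1+n)

  ν₂ℕ : ℕ → ℕ
  ν₂ℕ n = v2aux n n

  v2aux-fuel : ∀ {f g} x → x ≤ f → x ≤ g → v2aux f x ≡ v2aux g x
  v2aux-fuel {zero}  {zero}  zero _ _ = refl
  v2aux-fuel {zero}  {suc g} zero _ _ = refl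
  v2aux-fuel {suc f} {zero}  zero _ _ = refl
  v2aux-fuel {suc f} {suc g} zero _ _ = refl
  v2aux-fuel {suc f} {suc g} (suc x) x≤f x≤g with suc x % 2
  ... | zero  = cong suc (v2aux-fuel (suc x / 2) (m≤1+n⇒m/2≤n x≤f) (m≤1+n⇒m/2≤n x≤g))
  ... | suc _ = refl

  ν₂ℕ-odd : ∀ m → ν₂ℕ (suc (m * 2)) ≡ 0
  ν₂ℕ-odd m with suc (m * 2) % 2 | [r+kd]%d≡r {2} 1 m (s≤s (s≤s z≤n))
  ... | _ | refl = refl

  ν₂ℕ-double : ∀ n .{{_ : NonZero n}} → ν₂ℕ (n * 2) ≡ suc (ν₂ℕ n)
  ν₂ℕ-double n@(suc m) with n * 2 % 2 | ℕD.m*n%n≡0 n 2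
  ... | _ | refl = cong suc (trans (cong (v2aux (suc (m * 2))) (ℕD.m*n/n≡m n 2))
                                 (v2aux-fuel n (s≤s (ℕP.m≤m*n m 2)) ℕP.≤-refl))

  ν₂ℕ-2^k*odd : ∀ k h → ν₂ℕ (2 ^ k * suc (h * 2)) ≡ k
  ν₂ℕ-2^k*odd zero h = trans (cong ν₂ℕ (ℕP.*-identityˡ _)) (ν₂ℕ-odd h)
  ν₂ℕ-2^k*odd (suc k) h = begin
    ν₂ℕ (2 * 2 ^ k * o)     ≡⟨ cong ν₂ℕ (trans (ℕP.*-assoc 2 (2 ^ k) o) (ℕP.*-comm 2 (2 ^ k * o))) ⟩
    ν₂ℕ (2 ^ k * o * 2)     ≡⟨ ν₂ℕ-double (2 ^ k * o) {{ℕP.m*n≢0 _ _ {{ℕP.m^n≢0 2 k}}}} ⟩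
    suc (ν₂ℕ (2 ^ k * o))   ≡⟨ cong suc (ν₂ℕ-2^k*odd k h) ⟩
    suc k                   ∎
    where
    open ≡-Reasoning
    o = suc (h * 2)

  data Parity : ℕ → Set where
    even : ∀ h → Parity (h * 2)
    odd  : ∀ h → Parity (suc (h * 2))

  parity : ∀ u → Parity u
  parity zero = even 0
  parity (suc u) with parity u
  ... | even h = odd h
  ... | odd h  = even (suc h)

  popcount : ℕ → ℕ → ℕ
  popcount zero    y = 0
  popcount (suc K) y = nz (y % 2) + popcount K (y / 2)

  s₂ : ℕ → ℕ
  s₂ y = popcount (suc y) y

  popcount-0 : ∀ K → popcount K 0 ≡ 0
  popcount-0 zero    = refl
  popcount-0 (suc K) = popcount-0 K

  popcount-fuel : ∀ {f g} y → y ≤ f → y ≤ g → popcount f y ≡ popcount g y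
  popcount-fuel {zero}  {g}     y y≤0 _ rewrite ℕP.n≤0⇒n≡0 y≤0 = sym (popcount-0 g)
  popcount-fuel {suc f} {zero}  y _ y≤0 rewrite ℕP.n≤0⇒n≡0 y≤0 = popcount-0 (suc f)
  popcount-fuel {suc f} {suc g} y y≤f y≤g =
    cong (_+_ (nz (y % 2))) (popcount-fuel (y / 2) (m≤1+n⇒m/2≤n y≤f) (m≤1+n⇒m/2≤n y≤g))

  s₂-even : ∀ u → s₂ (u * 2) ≡ s₂ u
  s₂-even u = begin
    nz ((0 + u * 2) % 2) + popcount (u * 2) ((0 + u * 2) / 2)
      ≡⟨ cong₂ (λ r q → nz r + popcount (u * 2) q) ([r+kd]%d≡r 0 u (s≤s z≤n)) ([r+kd]/d≡k 0 u (s≤s z≤n)) ⟩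
    popcount (u * 2) u
      ≡⟨ popcount-fuel u (ℕP.m≤m*n u 2) (ℕP.n≤1+n u) ⟩
    s₂ u ∎
    where open ≡-Reasoning

  s₂-odd : ∀ u → s₂ (suc (u * 2)) ≡ suc (s₂ u)
  s₂-odd u = begin
    nz ((1 + u * 2) % 2) + popcount (suc (u * 2)) ((1 + u * 2) / 2)
      ≡⟨ cong₂ (λ r q → nz r + popcount (suc (u * 2)) q) ([r+kd]%d≡r 1 u 1<2) ([r+kd]/d≡k 1 u 1<2) ⟩
    suc (popcount (suc (u * 2)) u)
      ≡⟨ cong suc (popcount-fuel u (ℕP.m≤n⇒m≤1+n (ℕP.m≤m*n u 2)) (ℕP.n≤1+n u)) ⟩
    suc (s₂ u) ∎
    where
    open ≡-Reasoning
    1<2 : 1 < 2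
    1<2 = s≤s (s≤s z≤n)

  ν₂ℕ+s₂-carry : ∀ u → ν₂ℕ (suc u) + s₂ (suc u) ≡ suc (s₂ u)
  ν₂ℕ+s₂-carry = <-rec _ carry
    where
    carry : ∀ u → (∀ {h} → h < u → ν₂ℕ (suc h) + s₂ (suc h) ≡ suc (s₂ h)) →
            ν₂ℕ (suc u) + s₂ (suc u) ≡ suc (s₂ u)
    carry u ih with parity u
    ... | even h = cong₂ _+_ (ν₂ℕ-odd h) (trans (s₂-odd h) (cong suc (sym (s₂-even h))))
    ... | odd h = begin
      ν₂ℕ (suc h * 2) + s₂ (suc h * 2)   ≡⟨ cong₂ _+_ (ν₂ℕ-double (suc h)) (s₂-even (suc h)) ⟩
      suc (ν₂ℕ (suc h) + s₂ (suc h))     ≡⟨ cong suc (ih (s≤s (ℕP.m≤m*n h 2))) ⟩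
      suc (suc (s₂ h))                   ≡⟨ cong suc (sym (s₂-odd h)) ⟩
      suc (s₂ (suc (h * 2)))             ∎
      where open ≡-Reasoning

  digitCount : ℕ → ℕ → ℕ
  digitCount zero    y = 0
  digitCount (suc K) y = digitCount K y + nz (bit K y)

  digitCount-shift : ∀ K y → digitCount (suc K) y ≡ nz (y % 2) + digitCount K (y / 2)
  digitCount-shift zero    y = ℕP.+-comm 0 (nz (y % 2))
  digitCount-shift (suc K) y = trans (cong (_+ nz (bit K (y / 2))) (digitCount-shift K y))
                                     (ℕP.+-assoc (nz (y % 2)) _ _)

  digitCount≡popcount : ∀ K y → digitCount K y ≡ popcount K y
  digitCount≡popcount zero    y = refl
  digitCount≡popcount (suc K) y =
    trans (digitCount-shift K y) (cong (_+_ (nz (y % 2))) (digitCount≡popcount K (y / 2)))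

  countNZ-split : ∀ K m → countNZ (suc K) m ≡ nz (m % 3) + digitCount K (m / 3)
  countNZ-split zero    m = sym (ℕP.+-identityʳ _)
  countNZ-split (suc K) m = trans (cong (_+ nz (bit K (m / 3))) (countNZ-split K m))
                             (ℕP.+-assoc (nz (m % 3)) _ _)

  ζF≡nz+s₂ : ∀ m → ζF m ≡ nz (m % 3) + s₂ (m / 3)
  ζF≡nz+s₂ m = trans (countNZ-split m m) (cong (_+_ (nz (m % 3)))
    (trans (digitCount≡popcount m (m / 3)) (popcount-fuel (m / 3) (ℕD.m/n≤m m 3) (ℕP.n≤1+n _))))

  ζF-r+3k : ∀ r k → r < 3 → ζF (r + k * 3) ≡ nz r + s₂ k
  ζF-r+3k r k r<3 = trans (ζF≡nz+s₂ (r + k * 3))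
    (cong₂ (λ r′ k′ → nz r′ + s₂ k′) ([r+kd]%d≡r r k r<3) ([r+kd]/d≡k r k r<3))

  -- ν₂(C_n) + 1 − ζ_F(n+1) as a function of ν₂(s²+3t) − 1 and n mod 6.
  excess : ℕ → ℕ → ℕ
  excess e 3 = e
  excess e 4 = e
  excess e _ = 0

  excess-0 : ∀ ρ → excess 0 ρ ≡ 0
  excess-0 0 = refl
  excess-0 1 = refl
  excess-0 2 = refl
  excess-0 3 = refl
  excess-0 4 = refl
  excess-0 (suc (suc (suc (suc (suc _))))) = refl

  excess-other : ∀ e ρ → ¬ (ρ ≡ 3 ⊎ ρ ≡ 4) → excess e ρ ≡ 0
  excess-other e 0 _ = refl
  excess-other e 1 _ = refl
  excess-other e 2 _ = refl
  excess-other e 3 ρ∉ = ⊥-elim (ρ∉ (inj₁ refl))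
  excess-other e 4 ρ∉ = ⊥-elim (ρ∉ (inj₂ refl))
  excess-other e (suc (suc (suc (suc (suc _))))) _ = refl

  excess-special : ∀ e {ρ} → ρ ≡ 3 ⊎ ρ ≡ 4 → excess e ρ ≡ e
  excess-special e (inj₁ refl) = refl
  excess-special e (inj₂ refl) = refl

  r+u*6≡r+u*2*3 : ∀ r u → r + u * 6 ≡ r + u * 2 * 3
  r+u*6≡r+u*2*3 r u = cong (_+_ r) (sym (ℕP.*-assoc u 2 3))

  ζF-even-block : ∀ r u → r < 3 → ζF (r + u * 6) ≡ nz r + s₂ u
  ζF-even-block r u r<3 = trans (cong ζF (r+u*6≡r+u*2*3 r u))
    (trans (ζF-r+3k r (u * 2) r<3) (cong (_+_ (nz r)) (s₂-even u)))

  ζF-odd-block : ∀ r u → r < 3 → ζF (r + (3 + u * 6)) ≡ nz r + suc (s₂ u)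
  ζF-odd-block r u r<3 = trans (cong (λ x → ζF (r + (3 + x))) (sym (ℕP.*-assoc u 2 3)))
    (trans (ζF-r+3k r (suc (u * 2)) r<3) (cong (_+_ (nz r)) (s₂-odd u)))

  +-cancelˡ-twice : ∀ x {v w} → x + (x + v) ≡ x + (x + w) → v ≡ w
  +-cancelˡ-twice x eq = ℕP.+-cancelˡ-≡ x _ _ (ℕP.+-cancelˡ-≡ x _ _ eq)

  ≡ᵇ-refl : ∀ n → (n ℕ.≡ᵇ n) ≡ true
  ≡ᵇ-refl zero    = refl
  ≡ᵇ-refl (suc n) = ≡ᵇ-refl n

  ≡ᵇ-false : ∀ {m n} → m ≢ n → (m ℕ.≡ᵇ n) ≡ false
  ≡ᵇ-false {m} {n} m≢n with m ℕ.≡ᵇ n in eq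
  ... | false = refl
  ... | true  = ⊥-elim (m≢n (ℕP.≡ᵇ⇒≡ m n (subst T (sym eq) tt)))


-- Parity and exact 2-adic valuation of integers
module _ where
  open import Data.Integer using (_+_; _*_; -_; _^_)
  open import Data.Integer.Tactic.RingSolver using (solve; solve-∀)

  Odd : ℤ → Set
  Odd z = Σ[ w ∈ ℤ ] z ≡ + 2 * w + + 1

  Even : ℤ → Set
  Even z = Σ[ w ∈ ℤ ] z ≡ + 2 * w

  odd⇒¬even : ∀ {z} → Odd z → ¬ Even z
  odd⇒¬even {z} (w , z≡) (v , z≡′) = 2≢1 (ℕP.m*n≡1⇒m≡1 2 ∣ v - w ∣ (sym 1≡2∣v-w∣))
    where
    1≡2[v-w] : + 1 ≡ + 2 * (v - w)
    1≡2[v-w] = begin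
      + 1                         ≡⟨ solve (w ∷ []) ⟩
      (+ 2 * w + + 1) - + 2 * w   ≡⟨ cong (_- + 2 * w) (trans (sym z≡) z≡′) ⟩
      + 2 * v - + 2 * w           ≡⟨ solve (v ∷ w ∷ []) ⟩
      + 2 * (v - w)               ∎
      where open ≡-Reasoning
    1≡2∣v-w∣ : 1 ≡ 2 ℕ.* ∣ v - w ∣
    1≡2∣v-w∣ = trans (cong ∣_∣ 1≡2[v-w]) (ℤP.abs-* (+ 2) (v - w))
    2≢1 : 2 ≢ 1
    2≢1 ()

  odd-* : ∀ {x y} → Odd x → Odd y → Odd (x * y)
  odd-* (w , refl) (v , refl) = + 2 * w * v + w + v , solve (w ∷ v ∷ [])

  odd-neg : ∀ {x} → Odd x → Odd (- x)
  odd-neg (w , refl) = - w - + 1 , solve (w ∷ [])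

  even-or-odd : ∀ z → Even z ⊎ Odd z
  even-or-odd z with z ℤ./ + 2 | z ℤ.% + 2 | ℤD.n%d<d z (+ 2) | ℤD.a≡a%n+[a/n]*n z (+ 2)
  ... | q | 0 | _ | z≡ = inj₁ (q , trans z≡ (trans (ℤP.+-identityˡ _) (ℤP.*-comm q (+ 2))))
  ... | q | 1 | _ | z≡ = inj₂ (q , trans z≡ (trans (ℤP.+-comm (+ 1) (q * + 2)) (cong (_+ + 1) (ℤP.*-comm q (+ 2)))))
  ... | _ | suc (suc _) | s≤s (s≤s ()) | _

  ¬2∣⇒odd : ∀ z → ¬ (+ 2 ∣ z) → Odd z
  ¬2∣⇒odd z 2∤z with even-or-odd z
  ... | inj₂ z-odd = z-odd
  ... | inj₁ (w , refl) = ⊥-elim (2∤z (divides ∣ w ∣ (trans (ℤP.abs-* (+ 2) w) (ℕP.*-comm 2 ∣ w ∣))))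

  record Val₂ (z : ℤ) (k : ℕ) : Set where
    constructor val₂
    field
      oddPart     : ℤ
      oddPart-odd : Odd oddPart
      z≡2^k*oddPart : z ≡ (+ 2) ^ k * oddPart

  Val₂-odd : ∀ {z} → Odd z → Val₂ z 0
  Val₂-odd {z} z-odd = val₂ z z-odd (sym (ℤP.*-identityˡ z))

  Val₂-* : ∀ {x y a b} → Val₂ x a → Val₂ y b → Val₂ (x * y) (a ℕ.+ b)
  Val₂-* {a = a} {b} (val₂ o o-odd refl) (val₂ o′ o′-odd refl) = val₂ (o * o′) (odd-* o-odd o′-odd) (begin
    (+ 2) ^ a * o * ((+ 2) ^ b * o′)   ≡⟨ *-interchange ((+ 2) ^ a) o ((+ 2) ^ b) o′ ⟩
    (+ 2) ^ a * (+ 2) ^ b * (o * o′)   ≡⟨ cong (_* (o * o′)) (sym (ℤP.^-distribˡ-+-* (+ 2) a b)) ⟩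
    (+ 2) ^ (a ℕ.+ b) * (o * o′)     ∎)
    where open ≡-Reasoning

  Val₂-2* : ∀ {x a} → Val₂ x a → Val₂ (+ 2 * x) (suc a)
  Val₂-2* {a = a} (val₂ o o-odd refl) = val₂ o o-odd (sym (ℤP.*-assoc (+ 2) ((+ 2) ^ a) o))

  Val₂-0⇒odd : ∀ {x} → Val₂ x 0 → Odd x
  Val₂-0⇒odd (val₂ o o-odd refl) = subst Odd (sym (ℤP.*-identityˡ o)) o-odd

  Val₂⇒≢0 : ∀ {z k} → Val₂ z k → z ≢ + 0
  Val₂⇒≢0 {k = k} (val₂ o o-odd refl) 2^k*o≡0 with ℤP.i*j≡0⇒i≡0∨j≡0 ((+ 2) ^ k) 2^k*o≡0
  ... | inj₁ 2^k≡0 with ℤP.i^n≡0⇒i≡0 (+ 2) k 2^k≡0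
  ...   | ()
  Val₂⇒≢0 (val₂ o o-odd refl) _ | inj₂ refl = odd⇒¬even o-odd (+ 0 , refl)

  Val₂-exists : ∀ z → z ≢ + 0 → ∃[ k ] Val₂ z k
  Val₂-exists z = <-rec P step ∣ z ∣ z refl
    where
    P : ℕ → Set
    P n = ∀ z → ∣ z ∣ ≡ n → z ≢ + 0 → ∃[ k ] Val₂ z k
    step : ∀ n → (∀ {m} → m ℕ.< n → P m) → P n
    step n ih z refl z≢0 with even-or-odd z
    ... | inj₂ z-odd = 0 , Val₂-odd z-odd
    ... | inj₁ (w , refl) = suc k , Val₂-2* w-val
      where
      w≢0 : w ≢ + 0
      w≢0 refl = z≢0 refl
      instance
        ∣w∣≢0 : NonZero ∣ w ∣
        ∣w∣≢0 = ℕ.≢-nonZero (w≢0 ∘ ℤP.∣i∣≡0⇒i≡0)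
      ∣w∣<∣2w∣ : ∣ w ∣ ℕ.< ∣ + 2 * w ∣
      ∣w∣<∣2w∣ = subst (ℕ._<_ ∣ w ∣) (trans (ℕP.*-comm ∣ w ∣ 2) (sym (ℤP.abs-* (+ 2) w)))
                       (ℕP.m<m*n ∣ w ∣ 2 (s≤s (s≤s z≤n)))
      k = proj₁ (ih ∣w∣<∣2w∣ w refl w≢0)
      w-val = proj₂ (ih ∣w∣<∣2w∣ w refl w≢0)

  Val₂-exists-even : ∀ {x} → Even x → x ≢ + 0 → ∃[ e ] Val₂ x (suc e)
  Val₂-exists-even {x} x-even x≢0 with Val₂-exists x x≢0
  ... | suc e , x-val = e , x-val
  ... | 0 , x-val = ⊥-elim (odd⇒¬even (Val₂-0⇒odd x-val) x-even)

  Val₂-+-2^[1+v] : ∀ {x v} → Val₂ x v → ∀ w → Val₂ (x + (+ 2) ^ suc v * w) v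
  Val₂-+-2^[1+v] {v = v} (val₂ o (a , refl) refl) w =
    val₂ (+ 2 * (a + w) + + 1) (a + w , refl) (rearrange ((+ 2) ^ v) a w)
    where
    rearrange : ∀ P a w → P * (+ 2 * a + + 1) + + 2 * P * w ≡ P * (+ 2 * (a + w) + + 1)
    rearrange = solve-∀

  odd-∣∣ : ∀ {o} → Odd o → ∃[ h ] ∣ o ∣ ≡ suc (h ℕ.* 2)
  odd-∣∣ {o} o-odd with ∣ o ∣ / 2 | ∣ o ∣ % 2 | ℕD.m%n<n ∣ o ∣ 2 | ℕD.m≡m%n+[m/n]*n ∣ o ∣ 2
  ... | h | 1 | _ | ∣o∣≡ = h , ∣o∣≡
  ... | _ | suc (suc _) | s≤s (s≤s ()) | _
  ... | h | 0 | _ | ∣o∣≡ = ⊥-elim (odd⇒¬even o-odd (even-from-∣∣ o ∣o∣≡))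
    where
    even-from-∣∣ : ∀ z → ∣ z ∣ ≡ h ℕ.* 2 → Even z
    even-from-∣∣ (+ _) refl = + h , trans (ℤP.pos-* h 2) (ℤP.*-comm (+ h) (+ 2))
    even-from-∣∣ -[1+ _ ] ∣z∣≡ = - + h , (begin
      -[1+ _ ]        ≡⟨ cong (λ m → - + m) ∣z∣≡ ⟩
      - + (h ℕ.* 2)   ≡⟨ cong -_ (trans (ℤP.pos-* h 2) (ℤP.*-comm (+ h) (+ 2))) ⟩
      - (+ 2 * + h)   ≡⟨ ℤP.neg-distribʳ-* (+ 2) (+ h) ⟩
      + 2 * - + h     ∎)
      where open ≡-Reasoning

  +2^k≡+[2^k] : ∀ k → (+ 2) ^ k ≡ + (2 ℕ.^ k)
  +2^k≡+[2^k] zero = refl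
  +2^k≡+[2^k] (suc k) = trans (cong (+ 2 *_) (+2^k≡+[2^k] k)) (sym (ℤP.pos-* 2 (2 ℕ.^ k)))

  Val₂-∣∣ : ∀ {z k} → Val₂ z k → ∃[ h ] ∣ z ∣ ≡ 2 ℕ.^ k ℕ.* suc (h ℕ.* 2)
  Val₂-∣∣ {k = k} (val₂ o o-odd refl) =
    let h , ∣o∣≡ = odd-∣∣ o-odd in
    h , trans (ℤP.abs-* ((+ 2) ^ k) o) (cong₂ ℕ._*_ (cong ∣_∣ (+2^k≡+[2^k] k)) ∣o∣≡)

  ν₂≡ν₂ℕ∣∣ : ∀ z → z ≢ + 0 → ν₂ z ≡ fin (+ ν₂ℕ ∣ z ∣)
  ν₂≡ν₂ℕ∣∣ z z≢0 with ∣ z ∣ in ∣z∣≡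
  ... | zero  = ⊥-elim (z≢0 (ℤP.∣i∣≡0⇒i≡0 ∣z∣≡))
  ... | suc m = refl

  ν₂-Val₂ : ∀ {z k} → Val₂ z k → ν₂ z ≡ fin (+ k)
  ν₂-Val₂ {z} {k} z-val = let h , ∣z∣≡ = Val₂-∣∣ z-val in
    trans (ν₂≡ν₂ℕ∣∣ z (Val₂⇒≢0 z-val)) (cong (fin ∘ +_) (trans (cong ν₂ℕ ∣z∣≡) (ν₂ℕ-2^k*odd k h)))

  Val₂-unique : ∀ {z a b} → Val₂ z a → Val₂ z b → a ≡ b
  Val₂-unique z-val z-val′ with trans (sym (ν₂-Val₂ z-val)) (ν₂-Val₂ z-val′)
  ... | refl = refl

  divisible-by-all-2^k⇒0 : ∀ z → (∀ k → ∃[ w ] z ≡ (+ 2) ^ k * w) → z ≡ + 0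
  divisible-by-all-2^k⇒0 z 2^k∣z with z ℤ.≟ + 0
  ... | yes z≡0 = z≡0
  ... | no z≢0 =
    ⊥-elim (ℕP.m≢1+m+n k (Val₂-unique z-val (subst (λ x → Val₂ x (suc k ℕ.+ j)) (sym z≡) 2^[1+k]*w-val)))
    where
    k = proj₁ (Val₂-exists z z≢0)
    z-val = proj₂ (Val₂-exists z z≢0)
    w = proj₁ (2^k∣z (suc k))
    z≡ = proj₂ (2^k∣z (suc k))
    w≢0 : w ≢ + 0
    w≢0 w≡0 = z≢0 (trans z≡ (trans (cong ((+ 2) ^ suc k *_) w≡0) (ℤP.*-zeroʳ ((+ 2) ^ suc k))))
    j = proj₁ (Val₂-exists w w≢0)
    2^[1+k]*w-val : Val₂ ((+ 2) ^ suc k * w) (suc k ℕ.+ j)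
    2^[1+k]*w-val = Val₂-* (val₂ (+ 1) (+ 0 , refl) (sym (ℤP.*-identityʳ ((+ 2) ^ suc k))))
                           (proj₂ (Val₂-exists w w≢0))

  odd-2*+ : ∀ x {y} → Odd y → Odd (+ 2 * x + y)
  odd-2*+ x (w , refl) = x + w , regroup x w
    where
    regroup : ∀ x w → + 2 * x + (+ 2 * w + + 1) ≡ + 2 * (x + w) + + 1
    regroup = solve-∀

  odd+odd⇒even : ∀ {x y} → Odd x → Odd y → Even (x + y)
  odd+odd⇒even (w , refl) (v , refl) = w + v + + 1 , solve (w ∷ v ∷ [])

  Val₂-suc⇒even : ∀ {x e} → Val₂ x (suc e) → Even x
  Val₂-suc⇒even {e = e} (val₂ o _ refl) = (+ 2) ^ e * o , ℤP.*-assoc (+ 2) ((+ 2) ^ e) o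

  2-adic-decomposition : ∀ n .{{_ : NonZero n}} → ∃[ h ] n ≡ 2 ℕ.^ ν₂ℕ n ℕ.* suc (h ℕ.* 2)
  2-adic-decomposition n@(suc _) with Val₂-exists (+ n) (λ ())
  ... | k , n-val with Val₂-∣∣ n-val
  ...   | h , n≡ = h , trans n≡ (cong (λ j → 2 ℕ.^ j ℕ.* suc (h ℕ.* 2))
                                       (sym (trans (cong ν₂ℕ n≡) (ν₂ℕ-2^k*odd k h))))

  Val₂-cofactor : ∀ {x y c z f V W} → x * (y * (y * c)) ≡ z → Val₂ x f → Val₂ y V → Val₂ z W →
    ∃[ v ] Val₂ c v × f ℕ.+ (V ℕ.+ (V ℕ.+ v)) ≡ W
  Val₂-cofactor {x} {y} {c} {f = f} {V} eq x-val y-val z-val =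
    v , c-val , Val₂-unique (subst (λ z → Val₂ z (f ℕ.+ (V ℕ.+ (V ℕ.+ v)))) eq
                                   (Val₂-* x-val (Val₂-* y-val (Val₂-* y-val c-val))))
                            z-val
    where
    c≢0 : c ≢ + 0
    c≢0 c≡0 = Val₂⇒≢0 z-val (trans (sym eq) (trans (cong (λ c → x * (y * (y * c))) c≡0) (annihilate x y)))
      where
      annihilate : ∀ x y → x * (y * (y * + 0)) ≡ + 0
      annihilate = solve-∀
    v = proj₁ (Val₂-exists c c≢0)
    c-val = proj₂ (Val₂-exists c c≢0)


-- Lucas sequences
module _ where
  open import Data.Integer using (_+_; _*_; -_; _^_)
  open import Data.Integer.Tactic.RingSolver using (solve; solve-∀)

  lucas : ℤ → ℤ → ℕ → ℤ
  lucas p q 0 = + 0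
  lucas p q 1 = + 1
  lucas p q (suc (suc n)) = p * lucas p q (suc n) + q * lucas p q n

  Recurrence : ℤ → ℤ → (ℕ → ℤ) → Set
  Recurrence p q g = ∀ n → g (2 ℕ.+ n) ≡ p * g (1 ℕ.+ n) + q * g n

  recurrence⇒lucas : ∀ {p q g} → Recurrence p q g → g 0 ≡ + 0 → ∀ n → g n ≡ g 1 * lucas p q n
  recurrence⇒lucas {p} {q} {g} rec g0≡0 n = proj₁ (consecutive n)
    where
    consecutive : ∀ n → g n ≡ g 1 * lucas p q n × g (suc n) ≡ g 1 * lucas p q (suc n)
    consecutive zero = trans g0≡0 (sym (ℤP.*-zeroʳ (g 1))) , sym (ℤP.*-identityʳ (g 1))
    consecutive (suc n) = let eq₀ , eq₁ = consecutive n in eq₁ , (begin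
      g (2 ℕ.+ n)                                                ≡⟨ rec n ⟩
      p * g (1 ℕ.+ n) + q * g n                                  ≡⟨ cong₂ (λ x y → p * x + q * y) eq₁ eq₀ ⟩
      p * (g 1 * lucas p q (1 ℕ.+ n)) + q * (g 1 * lucas p q n)  ≡⟨ factor p q (g 1) _ _ ⟩
      g 1 * lucas p q (2 ℕ.+ n)                                  ∎)
      where
      open ≡-Reasoning
      factor : ∀ p q c x y → p * (c * x) + q * (c * y) ≡ c * (p * x + q * y)
      factor = solve-∀

  module _ (p q : ℤ) where

    lucas-2 : lucas p q 2 ≡ p
    lucas-2 = trans (cong (_+ q * + 0) (ℤP.*-identityʳ p)) (trans (cong (_+_ p) (ℤP.*-zeroʳ q)) (ℤP.+-identityʳ p))

    lucas-3 : lucas p q 3 ≡ p * p + q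
    lucas-3 = cong₂ _+_ (cong (p *_) lucas-2) (ℤP.*-identityʳ q)

    -- Each identity below is stated for arbitrary u₀, u₁, … linked by the recurrence,
    -- so that the ring solver sees the consecutive terms as variables.
    lucas-3+ : ∀ n → lucas p q (3 ℕ.+ n) ≡ (p * p + q) * lucas p q (1 ℕ.+ n) + p * q * lucas p q n
    lucas-3+ n = identity _ _ _ _ refl refl
      where
      identity : ∀ u₀ u₁ u₂ u₃ → u₂ ≡ p * u₁ + q * u₀ → u₃ ≡ p * u₂ + q * u₁ →
                 u₃ ≡ (p * p + q) * u₁ + p * q * u₀
      identity u₀ u₁ _ _ refl refl = solve (p ∷ q ∷ u₀ ∷ u₁ ∷ [])

    lucas-4+ : ∀ n → lucas p q (4 ℕ.+ n) ≡ (p * p + + 2 * q) * lucas p q (2 ℕ.+ n) + - (q * q) * lucas p q n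
    lucas-4+ n = identity _ _ _ _ _ refl refl refl
      where
      identity : ∀ u₀ u₁ u₂ u₃ u₄ → u₂ ≡ p * u₁ + q * u₀ → u₃ ≡ p * u₂ + q * u₁ → u₄ ≡ p * u₃ + q * u₂ →
                 u₄ ≡ (p * p + + 2 * q) * u₂ + - (q * q) * u₀
      identity u₀ u₁ _ _ _ refl refl refl = solve (p ∷ q ∷ u₀ ∷ u₁ ∷ [])

    lucas-6+ : ∀ n → lucas p q (6 ℕ.+ n) ≡ (p * p * p + + 3 * p * q) * lucas p q (3 ℕ.+ n) + q * q * q * lucas p q n
    lucas-6+ n = identity _ _ _ _ _ _ _ refl refl refl refl refl
      where
      identity : ∀ u₀ u₁ u₂ u₃ u₄ u₅ u₆ → u₂ ≡ p * u₁ + q * u₀ → u₃ ≡ p * u₂ + q * u₁ →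
                 u₄ ≡ p * u₃ + q * u₂ → u₅ ≡ p * u₄ + q * u₃ → u₆ ≡ p * u₅ + q * u₄ →
                 u₆ ≡ (p * p * p + + 3 * p * q) * u₃ + q * q * q * u₀
      identity u₀ u₁ _ _ _ _ _ refl refl refl refl refl = solve (p ∷ q ∷ u₀ ∷ u₁ ∷ [])

    lucas-*2 : ∀ n → lucas p q (n ℕ.* 2) ≡ p * lucas (p * p + + 2 * q) (- (q * q)) n
    lucas-*2 n = trans (recurrence⇒lucas {g = λ m → lucas p q (m ℕ.* 2)} (λ m → lucas-4+ (m ℕ.* 2)) refl n)
                       (cong (_* lucas (p * p + + 2 * q) (- (q * q)) n) lucas-2)

    lucas-*3 : ∀ n → lucas p q (n ℕ.* 3) ≡ (p * p + q) * lucas (p * p * p + + 3 * p * q) (q * q * q) n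
    lucas-*3 n = trans (recurrence⇒lucas {g = λ m → lucas p q (m ℕ.* 3)} (λ m → lucas-6+ (m ℕ.* 3)) refl n)
                       (cong (_* lucas (p * p * p + + 3 * p * q) (q * q * q) n) lucas-3)

  lucas-odd-at-odd : ∀ {p q} → Even p → Odd q → ∀ m → Odd (lucas p q (suc (m ℕ.* 2)))
  lucas-odd-at-odd _ _ zero = + 0 , refl
  lucas-odd-at-odd {q = q} (r , refl) q-odd (suc m) =
    subst (λ x → Odd (x + q * lucas (+ 2 * r) q (suc (m ℕ.* 2))))
          (sym (ℤP.*-assoc (+ 2) r (lucas (+ 2 * r) q (suc (suc (m ℕ.* 2))))))
          (odd-2*+ (r * lucas (+ 2 * r) q (suc (suc (m ℕ.* 2))))
                   (odd-* q-odd (lucas-odd-at-odd (r , refl) q-odd m)))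

  lucas-odd-3∤ : ∀ {p q} → Odd p → Odd q → ∀ m →
    Odd (lucas p q (1 ℕ.+ m ℕ.* 3)) × Odd (lucas p q (2 ℕ.+ m ℕ.* 3))
  lucas-odd-3∤ {p} {q} p-odd q-odd zero = (+ 0 , refl) , subst Odd (sym (lucas-2 p q)) p-odd
  lucas-odd-3∤ {p} {q} p-odd q-odd (suc m) =
    let odd₁ , odd₂ = lucas-odd-3∤ p-odd q-odd m
        r , p²+q≡2r = odd+odd⇒even (odd-* p-odd p-odd) q-odd
        step : ∀ i → Odd (lucas p q i) → Odd (lucas p q (3 ℕ.+ i))
        step i oddᵢ = subst Odd (sym (trans (lucas-3+ p q i)
                                   (cong (λ x → x * lucas p q (suc i) + p * q * lucas p q i) p²+q≡2r)))
                                (subst (λ x → Odd (x + p * q * lucas p q i))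
                                   (sym (ℤP.*-assoc (+ 2) r (lucas p q (suc i))))
                                   (odd-2*+ (r * lucas p q (suc i)) (odd-* (odd-* p-odd q-odd) oddᵢ)))
    in step (1 ℕ.+ m ℕ.* 3) odd₁ , step (2 ℕ.+ m ℕ.* 3) odd₂

  Val₂-p²+2q : ∀ {p q e} → Val₂ p (suc e) → Odd q → Val₂ (p * p + + 2 * q) 1
  Val₂-p²+2q {e = e} (val₂ o _ refl) (w , refl) =
    val₂ (+ 2 * (X * X + w) + + 1) (X * X + w , refl) (regroup ((+ 2) ^ e) o w)
    where
    X = (+ 2) ^ e * o
    regroup : ∀ P o w → + 2 * P * o * (+ 2 * P * o) + + 2 * (+ 2 * w + + 1) ≡
                        + 2 * + 1 * (+ 2 * (P * o * (P * o) + w) + + 1)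
    regroup = solve-∀

  lucas-Val₂-2^k*odd : ∀ {p q} → Val₂ p 1 → Odd q → ∀ k h → Val₂ (lucas p q (2 ℕ.^ k ℕ.* suc (h ℕ.* 2))) k
  lucas-Val₂-2^k*odd {p} {q} p-val q-odd zero h =
    subst (λ i → Val₂ (lucas p q i) 0) (sym (ℕP.*-identityˡ (suc (h ℕ.* 2))))
          (Val₂-odd (lucas-odd-at-odd (Val₂-suc⇒even p-val) q-odd h))
  lucas-Val₂-2^k*odd {p} {q} p-val q-odd (suc k) h =
    subst (λ i → Val₂ (lucas p q i) (suc k)) index≡
      (subst (λ x → Val₂ x (suc k)) (sym (lucas-*2 p q y))
        (Val₂-* p-val (lucas-Val₂-2^k*odd (Val₂-p²+2q p-val q-odd) (odd-neg (odd-* q-odd q-odd)) k h)))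
    where
    y = 2 ℕ.^ k ℕ.* suc (h ℕ.* 2)
    index≡ : y ℕ.* 2 ≡ 2 ℕ.^ suc k ℕ.* suc (h ℕ.* 2)
    index≡ = trans (ℕP.*-comm y 2) (sym (ℕP.*-assoc 2 (2 ℕ.^ k) (suc (h ℕ.* 2))))

  lucas-Val₂-*2 : ∀ {p q e} → Val₂ p (suc e) → Odd q → ∀ y .{{_ : NonZero y}} →
    Val₂ (lucas p q (y ℕ.* 2)) (suc e ℕ.+ ν₂ℕ y)
  lucas-Val₂-*2 {p} {q} p-val q-odd y = subst (λ x → Val₂ x _) (sym (lucas-*2 p q y))
    (Val₂-* p-val (subst (λ i → Val₂ (lucas p′ q′ i) (ν₂ℕ y)) (sym y≡)
      (lucas-Val₂-2^k*odd (Val₂-p²+2q p-val q-odd) (odd-neg (odd-* q-odd q-odd)) (ν₂ℕ y) h)))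
    where
    p′ = p * p + + 2 * q
    q′ = - (q * q)
    h = proj₁ (2-adic-decomposition y)
    y≡ = proj₂ (2-adic-decomposition y)

  lucasFactorial : ℤ → ℤ → ℕ → ℤ
  lucasFactorial p q zero    = + 1
  lucasFactorial p q (suc n) = lucasFactorial p q n * lucas p q (suc n)

  CatalanEquation : ℤ → ℤ → ℕ → ℤ → Set
  CatalanEquation s t n c =
    lucas s t (suc n) * (lucasFactorial s t n * (lucasFactorial s t n * c)) ≡ lucasFactorial s t (2 ℕ.* n)


-- Valuations of Lucas factorials, block by block
module BlockValuations (a e : ℕ) where
  open import Data.Nat using (_+_; _*_; _<_)
  open import Data.Nat.Tactic.RingSolver using (solve-∀)

  b : ℕ
  b = suc e

  -- For n = ρ + 6u: ν₂(U_{n+1}) = factorVal ρ u, ν₂({n}!) = prefixVal ρ u + blockVal u,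
  -- and ν₂({2n}!) = doubleVal ρ u (a = ν₂(s²+t), b = ν₂(s²+3t)).
  factorVal : ℕ → ℕ → ℕ
  factorVal 2 u = a
  factorVal 5 u = a + (b + ν₂ℕ (suc u))
  factorVal _ u = 0

  prefixVal : ℕ → ℕ → ℕ
  prefixVal 0 u = 0
  prefixVal 1 u = 0
  prefixVal 2 u = 0
  prefixVal 3 u = a
  prefixVal 4 u = a
  prefixVal 5 u = a
  prefixVal _ u = a + (a + (b + ν₂ℕ (suc u)))

  prefixVal-suc : ∀ ρ u → ρ < 6 → prefixVal ρ u + factorVal ρ u ≡ prefixVal (suc ρ) u
  prefixVal-suc 0 u _ = refl
  prefixVal-suc 1 u _ = refl
  prefixVal-suc 2 u _ = refl
  prefixVal-suc 3 u _ = ℕP.+-identityʳ a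
  prefixVal-suc 4 u _ = ℕP.+-identityʳ a
  prefixVal-suc 5 u _ = refl
  prefixVal-suc (suc (suc (suc (suc (suc (suc _)))))) u (s≤s (s≤s (s≤s (s≤s (s≤s (s≤s ()))))))

  blockVal : ℕ → ℕ
  blockVal zero    = 0
  blockVal (suc u) = prefixVal 6 u + blockVal u

  blockVal-odd : ∀ u → blockVal (suc (u * 2)) ≡ a + (a + (b + blockVal (u * 2)))
  blockVal-odd u = trans (cong (λ ν → a + (a + (b + ν)) + blockVal (u * 2)) (ν₂ℕ-odd u))
                         (regroup a b (blockVal (u * 2)))
    where
    regroup : ∀ a b B → a + (a + (b + 0)) + B ≡ a + (a + (b + B))
    regroup = solve-∀

  blockVal-even : ∀ u → blockVal (u * 2) ≡ blockVal u + (blockVal u + s₂ u)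
  blockVal-even zero = refl
  blockVal-even (suc u) = begin
    prefixVal 6 (suc (u * 2)) + blockVal (suc (u * 2))
      ≡⟨ cong₂ (λ ν B₂ → a + (a + (b + ν)) + B₂) (ν₂ℕ-double (suc u)) (blockVal-odd u) ⟩
    a + (a + (b + suc ν)) + (a + (a + (b + blockVal (u * 2))))
      ≡⟨ cong (λ B₂ → a + (a + (b + suc ν)) + (a + (a + (b + B₂)))) (blockVal-even u) ⟩
    a + (a + (b + suc ν)) + (a + (a + (b + (B + (B + s₂ u)))))
      ≡⟨ regroup₁ a b B ν (s₂ u) ⟩
    (a + (a + (b + ν))) + (a + (a + (b + (B + B)))) + suc (s₂ u)
      ≡⟨ cong (_+_ ((a + (a + (b + ν))) + (a + (a + (b + (B + B)))))) (sym (ν₂ℕ+s₂-carry u)) ⟩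
    (a + (a + (b + ν))) + (a + (a + (b + (B + B)))) + (ν + s₂ (suc u))
      ≡⟨ regroup₂ a b B ν (s₂ (suc u)) ⟩
    blockVal (suc u) + (blockVal (suc u) + s₂ (suc u)) ∎
    where
    open ≡-Reasoning
    ν = ν₂ℕ (suc u)
    B = blockVal u
    regroup₁ : ∀ a b B ν S → a + (a + (b + suc ν)) + (a + (a + (b + (B + (B + S))))) ≡
                             (a + (a + (b + ν))) + (a + (a + (b + (B + B)))) + suc S
    regroup₁ = solve-∀
    regroup₂ : ∀ a b B ν S → (a + (a + (b + ν))) + (a + (a + (b + (B + B)))) + (ν + S) ≡
                             a + (a + (b + ν)) + B + (a + (a + (b + ν)) + B + S)
    regroup₂ = solve-∀

  blockVal-odd-closed : ∀ u → blockVal (suc (u * 2)) ≡ a + blockVal u + (a + blockVal u + (b + s₂ u))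
  blockVal-odd-closed u = trans (blockVal-odd u) (trans (cong (λ B₂ → a + (a + (b + B₂))) (blockVal-even u))
                                                  (regroup a b (blockVal u) (s₂ u)))
    where
    regroup : ∀ a b B S → a + (a + (b + (B + (B + S)))) ≡ a + B + (a + B + (b + S))
    regroup = solve-∀

  cancel-even-block : ∀ u {v} → blockVal u + (blockVal u + v) ≡ blockVal (u * 2) → v ≡ s₂ u
  cancel-even-block u eq = +-cancelˡ-twice (blockVal u) (trans eq (blockVal-even u))

  cancel-odd-block : ∀ u {v} → a + blockVal u + (a + blockVal u + v) ≡ blockVal (suc (u * 2)) → v ≡ b + s₂ u
  cancel-odd-block u eq = +-cancelˡ-twice (a + blockVal u) (trans eq (blockVal-odd-closed u))

  1+b+S≡e+[2+S] : ∀ S → suc (b + S) ≡ e + suc (suc S)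
  1+b+S≡e+[2+S] S = sym (trans (ℕP.+-suc e (suc S)) (cong suc (ℕP.+-suc e S)))

  doubleVal : ℕ → ℕ → ℕ
  doubleVal 0 u = blockVal (u * 2)
  doubleVal 1 u = blockVal (u * 2)
  doubleVal 2 u = a + blockVal (u * 2)
  doubleVal 3 u = blockVal (suc (u * 2))
  doubleVal 4 u = blockVal (suc (u * 2))
  doubleVal _ u = a + blockVal (suc (u * 2))

  catalan-exponent : ∀ ρ u v → ρ < 6 →
    let V = prefixVal ρ u + blockVal u in
    factorVal ρ u + (V + (V + v)) ≡ doubleVal ρ u → suc v ≡ excess e ρ + ζF (suc ρ + u * 6)
  catalan-exponent 0 u v _ eq = trans (cong suc (cancel-even-block u eq)) (sym (ζF-even-block 1 u (s≤s (s≤s z≤n))))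
  catalan-exponent 1 u v _ eq = trans (cong suc (cancel-even-block u eq)) (sym (ζF-even-block 2 u (s≤s (s≤s (s≤s z≤n)))))
  catalan-exponent 2 u v _ eq = trans (cong suc (cancel-even-block u (ℕP.+-cancelˡ-≡ a _ _ eq)))
                                      (sym (ζF-odd-block 0 u (s≤s z≤n)))
  catalan-exponent 3 u v _ eq = trans (cong suc (cancel-odd-block u eq))
    (trans (1+b+S≡e+[2+S] (s₂ u)) (cong (_+_ e) (sym (ζF-odd-block 1 u (s≤s (s≤s z≤n))))))
  catalan-exponent 4 u v _ eq = trans (cong suc (cancel-odd-block u eq))
    (trans (1+b+S≡e+[2+S] (s₂ u)) (cong (_+_ e) (sym (ζF-odd-block 2 u (s≤s (s≤s (s≤s z≤n)))))))
  catalan-exponent 5 u v _ eq = ℕP.+-cancelˡ-≡ ν _ _ (begin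
    ν + suc v           ≡⟨ ℕP.+-suc ν v ⟩
    suc (ν + v)         ≡⟨ cong suc ν+v≡s₂u ⟩
    suc (s₂ u)          ≡⟨ sym (ν₂ℕ+s₂-carry u) ⟩
    ν + s₂ (suc u)      ≡⟨ cong (_+_ ν) (sym (ζF-even-block 0 (suc u) (s≤s z≤n))) ⟩
    ν + ζF (6 + u * 6)  ∎)
    where
    open ≡-Reasoning
    ν = ν₂ℕ (suc u)
    A = a + blockVal u
    regroupˡ : ∀ a b ν A v → a + (b + ν) + (A + (A + v)) ≡ a + b + (A + (A + (ν + v)))
    regroupˡ = solve-∀
    regroupʳ : ∀ a b A S → a + (A + (A + (b + S))) ≡ a + b + (A + (A + S))
    regroupʳ = solve-∀
    ν+v≡s₂u : ν + v ≡ s₂ u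
    ν+v≡s₂u = +-cancelˡ-twice A (ℕP.+-cancelˡ-≡ (a + b) _ _ (begin
      a + b + (A + (A + (ν + v)))     ≡⟨ sym (regroupˡ a b ν A v) ⟩
      a + (b + ν) + (A + (A + v))     ≡⟨ eq ⟩
      a + blockVal (suc (u * 2))      ≡⟨ cong (_+_ a) (blockVal-odd-closed u) ⟩
      a + (A + (A + (b + s₂ u)))      ≡⟨ regroupʳ a b A (s₂ u) ⟩
      a + b + (A + (A + s₂ u))        ∎))
  catalan-exponent (suc (suc (suc (suc (suc (suc _)))))) u v (s≤s (s≤s (s≤s (s≤s (s≤s (s≤s ())))))) _


module CatalanValuation {s t : ℤ} (s-odd : Odd s) (t-odd : Odd t) {a e : ℕ}
                        (a-val : Val₂ (s ℤ.* s ℤ.+ t) a) (b-val : Val₂ (s ℤ.* s ℤ.+ + 3 ℤ.* t) (suc e)) where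
  open import Data.Integer using (_+_; _*_)
  open import Data.Integer.Tactic.RingSolver using (solve-∀)
  open import Algebra.Properties.CommutativeSemigroup ℕP.+-commutativeSemigroup using (xy∙z≈xz∙y)
  open BlockValuations a e

  U : ℕ → ℤ
  U = lucas s t

  F : ℕ → ℤ
  F = lucasFactorial s t

  V-val : Val₂ (s * s * s + + 3 * s * t) (suc e)
  V-val = subst (λ x → Val₂ x (suc e)) (expand s t) (Val₂-* (Val₂-odd s-odd) b-val)
    where
    expand : ∀ s t → s * (s * s + + 3 * t) ≡ s * s * s + + 3 * s * t
    expand = solve-∀

  T-odd : Odd (t * t * t)
  T-odd = odd-* (odd-* t-odd t-odd) t-odd

  U-r+6u : ∀ r u {k} → Val₂ (U (r ℕ.+ u ℕ.* 2 ℕ.* 3)) k → Val₂ (U (r ℕ.+ u ℕ.* 6)) k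
  U-r+6u r u {k} = subst (λ i → Val₂ (U i) k) (sym (r+u*6≡r+u*2*3 r u))

  U-val : ∀ u ρ → ρ ℕ.< 6 → Val₂ (U (suc ρ ℕ.+ u ℕ.* 6)) (factorVal ρ u)
  U-val u 0 _ = U-r+6u 1 u (Val₂-odd (proj₁ (lucas-odd-3∤ s-odd t-odd (u ℕ.* 2))))
  U-val u 1 _ = U-r+6u 2 u (Val₂-odd (proj₂ (lucas-odd-3∤ s-odd t-odd (u ℕ.* 2))))
  U-val u 2 _ = U-r+6u 3 u (subst₂ Val₂ (sym (lucas-*3 s t (suc (u ℕ.* 2)))) (ℕP.+-identityʳ a)
    (Val₂-* a-val (Val₂-odd (lucas-odd-at-odd (Val₂-suc⇒even V-val) T-odd u))))
  U-val u 3 _ = U-r+6u 4 u (Val₂-odd (proj₁ (lucas-odd-3∤ s-odd t-odd (suc (u ℕ.* 2)))))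
  U-val u 4 _ = U-r+6u 5 u (Val₂-odd (proj₂ (lucas-odd-3∤ s-odd t-odd (suc (u ℕ.* 2)))))
  U-val u 5 _ = U-r+6u 6 u (subst (λ x → Val₂ x (factorVal 5 u)) (sym (lucas-*3 s t (suc u ℕ.* 2)))
    (Val₂-* a-val (lucas-Val₂-*2 V-val T-odd (suc u))))
  U-val u (suc (suc (suc (suc (suc (suc _)))))) (s≤s (s≤s (s≤s (s≤s (s≤s (s≤s ()))))))

  F-val : ∀ u ρ → ρ ℕ.≤ 6 → Val₂ (F (ρ ℕ.+ u ℕ.* 6)) (prefixVal ρ u ℕ.+ blockVal u)
  F-val zero    zero    _   = Val₂-odd (+ 0 , refl)
  F-val (suc u) zero    _   = F-val u 6 ℕP.≤-refl
  F-val u       (suc ρ) ρ<6 =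
    subst (Val₂ (F (suc ρ ℕ.+ u ℕ.* 6)))
          (trans (xy∙z≈xz∙y (prefixVal ρ u) (blockVal u) (factorVal ρ u))
                 (cong (ℕ._+ blockVal u) (prefixVal-suc ρ u ρ<6)))
          (Val₂-* (F-val u ρ (ℕP.<⇒≤ ρ<6)) (U-val u ρ ρ<6))

  F-val-double : ∀ ρ u → ρ ℕ.< 6 → Val₂ (F (2 ℕ.* (ρ ℕ.+ u ℕ.* 6))) (doubleVal ρ u)
  F-val-double ρ u ρ<6 = subst (λ i → Val₂ (F i) (doubleVal ρ u)) (sym (double ρ u)) (at ρ ρ<6)
    where
    double : ∀ ρ u → 2 ℕ.* (ρ ℕ.+ u ℕ.* 6) ≡ 2 ℕ.* ρ ℕ.+ u ℕ.* 2 ℕ.* 6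
    double = NatSolver.solve-∀
    at : ∀ ρ → ρ ℕ.< 6 → Val₂ (F (2 ℕ.* ρ ℕ.+ u ℕ.* 2 ℕ.* 6)) (doubleVal ρ u)
    at 0 _ = F-val (u ℕ.* 2) 0 z≤n
    at 1 _ = F-val (u ℕ.* 2) 2 (s≤s (s≤s z≤n))
    at 2 _ = F-val (u ℕ.* 2) 4 (s≤s (s≤s (s≤s (s≤s z≤n))))
    at 3 _ = F-val (suc (u ℕ.* 2)) 0 z≤n
    at 4 _ = F-val (suc (u ℕ.* 2)) 2 (s≤s (s≤s z≤n))
    at 5 _ = F-val (suc (u ℕ.* 2)) 4 (s≤s (s≤s (s≤s (s≤s z≤n))))
    at (suc (suc (suc (suc (suc (suc _)))))) (s≤s (s≤s (s≤s (s≤s (s≤s (s≤s ()))))))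

  ν₂-catalan : ∀ n c → CatalanEquation s t n c → ∃[ v ] Val₂ c v × suc v ≡ excess e (n % 6) ℕ.+ ζF (suc n)
  ν₂-catalan n c =
    subst (λ m → CatalanEquation s t m c → ∃[ v ] Val₂ c v × suc v ≡ excess e (n % 6) ℕ.+ ζF (suc m))
          (sym (ℕD.m≡m%n+[m/n]*n n 6)) (in-block (n % 6) (n / 6) (ℕD.m%n<n n 6))
    where
    in-block : ∀ ρ u → ρ ℕ.< 6 → CatalanEquation s t (ρ ℕ.+ u ℕ.* 6) c →
               ∃[ v ] Val₂ c v × suc v ≡ excess e ρ ℕ.+ ζF (suc (ρ ℕ.+ u ℕ.* 6))
    in-block ρ u ρ<6 eq =
      let v , c-val , v-eq = Val₂-cofactor eq (U-val u ρ ρ<6) (F-val u ρ (ℕP.<⇒≤ ρ<6)) (F-val-double ρ u ρ<6)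
      in v , c-val , catalan-exponent ρ u v ρ<6 v-eq


-- Evaluating integer polynomials
module _ where
  open import Data.Integer using (_+_; _*_; -_; _^_)
  open import Data.Integer.Tactic.RingSolver using (solve-∀)

  sumBelow : ℕ → (ℕ → ℤ) → ℤ
  sumBelow zero    f = + 0
  sumBelow (suc B) f = sumBelow B f + f B

  sumBelow-cong : ∀ B {f g} → (∀ i → f i ≡ g i) → sumBelow B f ≡ sumBelow B g
  sumBelow-cong zero    f≗g = refl
  sumBelow-cong (suc B) f≗g = cong₂ _+_ (sumBelow-cong B f≗g) (f≗g B)

  sumBelow-+ : ∀ B f g → sumBelow B (λ i → f i + g i) ≡ sumBelow B f + sumBelow B g
  sumBelow-+ zero    f g = refl
  sumBelow-+ (suc B) f g = trans (cong (_+ (f B + g B)) (sumBelow-+ B f g))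
                                 (interchange (sumBelow B f) (sumBelow B g) (f B) (g B))
    where
    interchange : ∀ a b c d → a + b + (c + d) ≡ a + c + (b + d)
    interchange = solve-∀

  sumBelow-0 : ∀ B f → (∀ i → i ℕ.< B → f i ≡ + 0) → sumBelow B f ≡ + 0
  sumBelow-0 zero    f f≡0 = refl
  sumBelow-0 (suc B) f f≡0 = cong₂ _+_ (sumBelow-0 B f (λ i i<B → f≡0 i (ℕP.m<n⇒m<1+n i<B))) (f≡0 B ℕP.≤-refl)

  sumBelow-indicator : ∀ B l (g : ℕ → ℤ) → l ℕ.< B → sumBelow B (λ j → if l ℕ.≡ᵇ j then g j else + 0) ≡ g l
  sumBelow-indicator (suc B) l g l<1+B with ℕP.m≤n⇒m<n∨m≡n (ℕP.≤-pred l<1+B)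
  ... | inj₁ l<B rewrite sumBelow-indicator B l g l<B | ≡ᵇ-false (ℕP.<⇒≢ l<B) = ℤP.+-identityʳ (g l)
  ... | inj₂ refl rewrite ≡ᵇ-refl l =
    trans (cong (_+ g l) (sumBelow-0 l _ (λ i i<l → cong (λ b → if b then g i else + 0) (≡ᵇ-false (ℕP.>⇒≢ i<l)))))
          (ℤP.+-identityˡ (g l))


module Evaluation (s t : ℤ) where
  open import Data.Integer using (_+_; _*_; _^_)
  open import Data.Integer.Tactic.RingSolver using (solve-∀)

  ev : Poly → ℤ
  ev P = eval P s t

  term : Term → ℤ
  term (c , i , j) = c * s ^ i * t ^ j

  eval-++ : ∀ P Q → ev (P ++ Q) ≡ ev P + ev Q
  eval-++ []      Q = sym (ℤP.+-identityˡ (ev Q))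
  eval-++ (a ∷ P) Q = trans (cong (_+_ (term a)) (eval-++ P Q)) (sym (ℤP.+-assoc (term a) (ev P) (ev Q)))

  term-mulT : ∀ a b → term (mulT a b) ≡ term a * term b
  term-mulT (c , i , j) (d , k , l)
    rewrite ℤP.^-distribˡ-+-* s i k | ℤP.^-distribˡ-+-* t j l = regroup c d (s ^ i) (s ^ k) (t ^ j) (t ^ l)
    where
    regroup : ∀ c d a b e f → c * d * (a * b) * (e * f) ≡ c * a * e * (d * b * f)
    regroup = solve-∀

  eval-map-mulT : ∀ a Q → ev (map (mulT a) Q) ≡ term a * ev Q
  eval-map-mulT a []      = sym (ℤP.*-zeroʳ (term a))
  eval-map-mulT a (b ∷ Q) = trans (cong₂ _+_ (term-mulT a b) (eval-map-mulT a Q))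
                                  (sym (ℤP.*-distribˡ-+ (term a) (term b) (ev Q)))

  eval-⊗ : ∀ P Q → ev (P ⊗ Q) ≡ ev P * ev Q
  eval-⊗ []      Q = refl
  eval-⊗ (a ∷ P) Q = trans (eval-++ (map (mulT a) Q) (P ⊗ Q))
    (trans (cong₂ _+_ (eval-map-mulT a Q) (eval-⊗ P Q)) (sym (ℤP.*-distribʳ-+ (ev Q) (term a) (ev P))))

  eval-mulS : ∀ P → ev (mulS P) ≡ s * ev P
  eval-mulS []              = sym (ℤP.*-zeroʳ s)
  eval-mulS ((c , i , j) ∷ P) = trans (cong₂ _+_ (regroup c s (s ^ i) (t ^ j)) (eval-mulS P))
                                      (sym (ℤP.*-distribˡ-+ s (term (c , i , j)) (ev P)))
    where
    regroup : ∀ c s a b → c * (s * a) * b ≡ s * (c * a * b)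
    regroup = solve-∀

  eval-mulTv : ∀ P → ev (mulTv P) ≡ t * ev P
  eval-mulTv []              = sym (ℤP.*-zeroʳ t)
  eval-mulTv ((c , i , j) ∷ P) = trans (cong₂ _+_ (regroup c t (s ^ i) (t ^ j)) (eval-mulTv P))
                                       (sym (ℤP.*-distribˡ-+ t (term (c , i , j)) (ev P)))
    where
    regroup : ∀ c t a b → c * a * (t * b) ≡ t * (c * a * b)
    regroup = solve-∀

  eval-luc : ∀ n → ev (luc n) ≡ lucas s t n
  eval-luc 0             = refl
  eval-luc 1             = refl
  eval-luc (suc (suc n)) = trans (eval-++ (mulS (luc (suc n))) (mulTv (luc n)))
    (cong₂ _+_ (trans (eval-mulS (luc (suc n))) (cong (s *_) (eval-luc (suc n))))
               (trans (eval-mulTv (luc n)) (cong (t *_) (eval-luc n))))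

  eval-lucFact : ∀ n → ev (lucFact n) ≡ lucasFactorial s t n
  eval-lucFact zero    = refl
  eval-lucFact (suc n) = trans (eval-⊗ (lucFact n) (luc (suc n))) (cong₂ _*_ (eval-lucFact n) (eval-luc (suc n)))

  monomial : Poly → ℕ → ℕ → ℤ
  monomial P i j = coeff P i j * s ^ i * t ^ j

  boxSum : ℕ → (ℕ → ℕ → ℤ) → ℤ
  boxSum B g = sumBelow B (λ i → sumBelow B (g i))

  boxSum-+ : ∀ B f g → boxSum B (λ i j → f i j + g i j) ≡ boxSum B f + boxSum B g
  boxSum-+ B f g = trans (sumBelow-cong B (λ i → sumBelow-+ B (f i) (g i))) (sumBelow-+ B _ _)

  boxSum-indicator : ∀ B k l (g : ℕ → ℕ → ℤ) → k ℕ.< B → l ℕ.< B →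
    boxSum B (λ i j → if (k ℕ.≡ᵇ i) ∧ (l ℕ.≡ᵇ j) then g i j else + 0) ≡ g k l
  boxSum-indicator B k l g k<B l<B = trans (sumBelow-cong B row) (sumBelow-indicator B k (λ i → g i l) k<B)
    where
    row : ∀ i → sumBelow B (λ j → if (k ℕ.≡ᵇ i) ∧ (l ℕ.≡ᵇ j) then g i j else + 0) ≡
                (if k ℕ.≡ᵇ i then g i l else + 0)
    row i with k ℕ.≡ᵇ i
    ... | true  = sumBelow-indicator B l (g i) l<B
    ... | false = sumBelow-0 B _ (λ _ _ → refl)

  monomial-∷ : ∀ c k l P i j → monomial ((c , k , l) ∷ P) i j ≡
    monomial P i j + (if (k ℕ.≡ᵇ i) ∧ (l ℕ.≡ᵇ j) then c * s ^ i * t ^ j else + 0)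
  monomial-∷ c k l P i j with (k ℕ.≡ᵇ i) ∧ (l ℕ.≡ᵇ j)
  ... | true  = distrib c (coeff P i j) (s ^ i) (t ^ j)
    where
    distrib : ∀ c x a b → (c + x) * a * b ≡ x * a * b + c * a * b
    distrib = solve-∀
  ... | false = sym (ℤP.+-identityʳ _)

  Bounded : ℕ → Poly → Set
  Bounded B = All (λ { (_ , i , j) → i ℕ.< B × j ℕ.< B })

  eval≡boxSum : ∀ B P → Bounded B P → ev P ≡ boxSum B (monomial P)
  eval≡boxSum B [] _ = sym (sumBelow-0 B _ (λ i _ → sumBelow-0 B _ (λ j _ → refl)))
  eval≡boxSum B ((c , k , l) ∷ P) ((k<B , l<B) All.∷ P-bounded) = sym (begin
    boxSum B (monomial ((c , k , l) ∷ P))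
      ≡⟨ sumBelow-cong B (λ i → sumBelow-cong B (monomial-∷ c k l P i)) ⟩
    boxSum B (λ i j → monomial P i j + (if (k ℕ.≡ᵇ i) ∧ (l ℕ.≡ᵇ j) then c * s ^ i * t ^ j else + 0))
      ≡⟨ boxSum-+ B _ _ ⟩
    boxSum B (monomial P) + boxSum B (λ i j → if (k ℕ.≡ᵇ i) ∧ (l ℕ.≡ᵇ j) then c * s ^ i * t ^ j else + 0)
      ≡⟨ cong₂ _+_ (sym (eval≡boxSum B P P-bounded)) (boxSum-indicator B k l (λ i j → c * s ^ i * t ^ j) k<B l<B) ⟩
    ev P + term (c , k , l)
      ≡⟨ ℤP.+-comm (ev P) _ ⟩
    ev ((c , k , l) ∷ P) ∎)
    where open ≡-Reasoning

  bound : Poly → ℕ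
  bound []              = 0
  bound ((_ , i , j) ∷ P) = suc (i ℕ.+ j) ℕ.+ bound P

  Bounded-mono : ∀ {B B′} P → B ℕ.≤ B′ → Bounded B P → Bounded B′ P
  Bounded-mono P B≤B′ = All.map (λ (i<B , j<B) → ℕP.<-≤-trans i<B B≤B′ , ℕP.<-≤-trans j<B B≤B′)

  Bounded-bound : ∀ P → Bounded (bound P) P
  Bounded-bound [] = All.[]
  Bounded-bound ((_ , i , j) ∷ P) =
    (ℕP.≤-trans (s≤s (ℕP.m≤m+n i j)) (ℕP.m≤m+n _ (bound P)) ,
     ℕP.≤-trans (s≤s (ℕP.m≤n+m j i)) (ℕP.m≤m+n _ (bound P))) All.∷
    Bounded-mono P (ℕP.m≤n+m (bound P) _) (Bounded-bound P)

  eval-≈ₚ : ∀ {P Q} → P ≈ₚ Q → ev P ≡ ev Q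
  eval-≈ₚ {P} {Q} P≈Q = begin
    ev P
      ≡⟨ eval≡boxSum B P (Bounded-mono P (ℕP.m≤m+n _ _) (Bounded-bound P)) ⟩
    boxSum B (monomial P)
      ≡⟨ sumBelow-cong B (λ i → sumBelow-cong B (λ j → cong (λ x → x * s ^ i * t ^ j) (P≈Q i j))) ⟩
    boxSum B (monomial Q)
      ≡⟨ sym (eval≡boxSum B Q (Bounded-mono Q (ℕP.m≤n+m _ _) (Bounded-bound Q))) ⟩
    ev Q ∎
    where
    open ≡-Reasoning
    B = bound P ℕ.+ bound Q

  catalan-equation : ∀ {n C} → IsCatalan n C → CatalanEquation s t n (ev C)
  catalan-equation {n} {C} isCat = begin
    lucas s t (suc n) * (lucasFactorial s t n * (lucasFactorial s t n * ev C))
      ≡⟨ sym (cong₂ _*_ (eval-luc (suc n)) (cong₂ _*_ (eval-lucFact n) (cong (_* ev C) (eval-lucFact n)))) ⟩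
    ev (luc (suc n)) * (ev (lucFact n) * (ev (lucFact n) * ev C))
      ≡⟨ sym (trans (eval-⊗ (luc (suc n)) _) (cong (ev (luc (suc n)) *_)
              (trans (eval-⊗ (lucFact n) _) (cong (ev (lucFact n) *_) (eval-⊗ (lucFact n) C))))) ⟩
    ev (luc (suc n) ⊗ (lucFact n ⊗ (lucFact n ⊗ C)))
      ≡⟨ eval-≈ₚ {luc (suc n) ⊗ (lucFact n ⊗ (lucFact n ⊗ C))} {lucFact (2 ℕ.* n)} isCat ⟩
    ev (lucFact (2 ℕ.* n))
      ≡⟨ eval-lucFact (2 ℕ.* n) ⟩
    lucasFactorial s t (2 ℕ.* n) ∎
    where open ≡-Reasoning


-- The theorem, with degenerate parameters removed by perturbing t
module _ where
  open import Data.Integer using (_+_; _*_; -_; _^_)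
  open import Data.Integer.Tactic.RingSolver using (solve-∀)

  ν₂-catalan-generic : ∀ {s t e} → Odd s → Odd t → s * s + t ≢ + 0 → Val₂ (s * s + + 3 * t) (suc e) →
    ∀ n C → IsCatalan n C → ∃[ v ] Val₂ (eval C s t) v × suc v ≡ excess e (n % 6) ℕ.+ ζF (suc n)
  ν₂-catalan-generic {s} {t} s-odd t-odd s²+t≢0 b-val n C isCat =
    CatalanValuation.ν₂-catalan s-odd t-odd (proj₂ (Val₂-exists _ s²+t≢0)) b-val n (eval C s t)
      (Evaluation.catalan-equation s t {n} {C} isCat)

  ^-shift : ∀ j t d → ∃[ w ] (t + d) ^ j ≡ t ^ j + d * w
  ^-shift zero    t d = + 0 , sym (trans (cong (_+_ (+ 1)) (ℤP.*-zeroʳ d)) (ℤP.+-identityʳ (+ 1)))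
  ^-shift (suc j) t d = let w , eq = ^-shift j t d in
    t ^ j + (t + d) * w , trans (cong ((t + d) *_) eq) (regroup t d (t ^ j) w)
    where
    regroup : ∀ t d T w → (t + d) * (T + d * w) ≡ t * T + d * (T + (t + d) * w)
    regroup = solve-∀

  eval-shift : ∀ P s t d → ∃[ w ] eval P s (t + d) ≡ eval P s t + d * w
  eval-shift [] s t d = + 0 , sym (trans (ℤP.+-identityˡ _) (ℤP.*-zeroʳ d))
  eval-shift ((c , i , j) ∷ P) s t d =
    let wⱼ , eqⱼ = ^-shift j t d ; w , eq = eval-shift P s t d in
    c * s ^ i * wⱼ + w ,
    trans (cong₂ (λ x y → c * s ^ i * x + y) eqⱼ eq) (regroup (c * s ^ i) (t ^ j) (eval P s t) d wⱼ w)
    where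
    regroup : ∀ C T E d wⱼ w → C * (T + d * wⱼ) + (E + d * w) ≡ C * T + E + d * (C * wⱼ + w)
    regroup = solve-∀

  odd-mod4 : ∀ t → Odd t →
    (t ℤ.% + 4 ≡ 1 × ∃[ k ] t ≡ + 1 + + 4 * k) ⊎ (t ℤ.% + 4 ≡ 3 × ∃[ k ] t ≡ + 3 + + 4 * k)
  odd-mod4 t t-odd with t ℤ./ + 4 | t ℤ.% + 4 | ℤD.n%d<d t (+ 4) | ℤD.a≡a%n+[a/n]*n t (+ 4)
  ... | k | 0 | _ | t≡ = ⊥-elim (odd⇒¬even t-odd (+ 2 * k , trans t≡ (regroup k)))
    where
    regroup : ∀ k → + 0 + k * + 4 ≡ + 2 * (+ 2 * k)
    regroup = solve-∀
  ... | k | 1 | _ | t≡ = inj₁ (refl , k , trans t≡ (cong (_+_ (+ 1)) (ℤP.*-comm k (+ 4))))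
  ... | k | 2 | _ | t≡ = ⊥-elim (odd⇒¬even t-odd (+ 1 + + 2 * k , trans t≡ (regroup k)))
    where
    regroup : ∀ k → + 2 + k * + 4 ≡ + 2 * (+ 1 + + 2 * k)
    regroup = solve-∀
  ... | k | 3 | _ | t≡ = inj₂ (refl , k , trans t≡ (cong (_+_ (+ 3)) (ℤP.*-comm k (+ 4))))
  ... | _ | suc (suc (suc (suc _))) | s≤s (s≤s (s≤s (s≤s ()))) | _

  Val₂-s²+[1+4k] : ∀ {s} k → Odd s → Val₂ (s * s + (+ 1 + + 4 * k)) 1
  Val₂-s²+[1+4k] k (w , refl) = val₂ _ (w * w + w + k , refl) (regroup w k)
    where
    regroup : ∀ w k → (+ 2 * w + + 1) * (+ 2 * w + + 1) + (+ 1 + + 4 * k) ≡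
                      + 2 * + 1 * (+ 2 * (w * w + w + k) + + 1)
    regroup = solve-∀

  Val₂-s²+3[3+4k] : ∀ {s} k → Odd s → Val₂ (s * s + + 3 * (+ 3 + + 4 * k)) 1
  Val₂-s²+3[3+4k] k (w , refl) = val₂ _ (w * w + w + + 2 + + 3 * k , refl) (regroup w k)
    where
    regroup : ∀ w k → (+ 2 * w + + 1) * (+ 2 * w + + 1) + + 3 * (+ 3 + + 4 * k) ≡
                      + 2 * + 1 * (+ 2 * (w * w + w + + 2 + + 3 * k) + + 1)
    regroup = solve-∀

  Val₂-eval-shift : ∀ P {s t v} j m → Val₂ (eval P s (t + (+ 2) ^ (suc v ℕ.+ j) * m)) v → Val₂ (eval P s t) v
  Val₂-eval-shift P {s} {t} {v} j m shifted-val =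
    let w , eq = eval-shift P s t ((+ 2) ^ (suc v ℕ.+ j) * m) in
    subst (λ x → Val₂ x v) (undo eq) (Val₂-+-2^[1+v] shifted-val ((+ 2) ^ j * - (m * w)))
    where
    undo : ∀ {x y w} → x ≡ y + (+ 2) ^ (suc v ℕ.+ j) * m * w → x + (+ 2) ^ suc v * ((+ 2) ^ j * - (m * w)) ≡ y
    undo {x} {y} {w} refl rewrite ℤP.^-distribˡ-+-* (+ 2) (suc v) j = cancel y ((+ 2) ^ suc v) ((+ 2) ^ j) m w
      where
      cancel : ∀ y A B m w → y + A * B * m * w + A * (B * - (m * w)) ≡ y
      cancel = solve-∀

  ∣x∣<∣y∣⇒x+y≢0 : ∀ x y → ∣ x ∣ ℕ.< ∣ y ∣ → x + y ≢ + 0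
  ∣x∣<∣y∣⇒x+y≢0 x y ∣x∣<∣y∣ x+y≡0 = ℕP.<-irrefl (trans (cong ∣_∣ x≡-y) (ℤP.∣-i∣≡∣i∣ y)) ∣x∣<∣y∣
    where
    regroup : ∀ x y → x ≡ x + y - y
    regroup = solve-∀
    x≡-y : x ≡ - y
    x≡-y = trans (regroup x y) (trans (cong (_- y) x+y≡0) (ℤP.+-identityˡ (- y)))

  shift-to-generic : ∀ s {t} K → Odd t → ∃[ m ] (Odd (t + (+ 2) ^ suc K * m) ×
    s * s + (t + (+ 2) ^ suc K * m) ≢ + 0 × s * s + + 3 * (t + (+ 2) ^ suc K * m) ≢ + 0)
  shift-to-generic s {t} K (w , t≡) = + M , t′-odd , nz₁ , nz₂
    where
    A = s * s + t
    B = s * s + + 3 * t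
    M = suc (∣ A ∣ ℕ.+ ∣ B ∣)
    N = 2 ℕ.^ suc K ℕ.* M
    d = (+ 2) ^ suc K * + M
    ∣d∣≡N : ∣ d ∣ ≡ N
    ∣d∣≡N = trans (ℤP.abs-* ((+ 2) ^ suc K) (+ M)) (cong (ℕ._* M) (cong ∣_∣ (+2^k≡+[2^k] (suc K))))
    M≤N : M ℕ.≤ N
    M≤N = ℕP.m≤n*m M (2 ℕ.^ suc K) {{ℕP.m^n≢0 2 (suc K)}}
    t′-odd : Odd (t + d)
    t′-odd = w + (+ 2) ^ K * + M , trans (cong (_+ d) t≡) (regroup w ((+ 2) ^ K) (+ M))
      where
      regroup : ∀ w P M → + 2 * w + + 1 + + 2 * P * M ≡ + 2 * (w + P * M) + + 1
      regroup = solve-∀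
    nz₁ : s * s + (t + d) ≢ + 0
    nz₁ = subst (_≢ + 0) (ℤP.+-assoc (s * s) t d)
      (∣x∣<∣y∣⇒x+y≢0 A d (ℕP.<-≤-trans (s≤s (ℕP.m≤m+n ∣ A ∣ ∣ B ∣))
                                       (subst (M ℕ.≤_) (sym ∣d∣≡N) M≤N)))
    nz₂ : s * s + + 3 * (t + d) ≢ + 0
    nz₂ = subst (_≢ + 0) (regroup (s * s) t d)
      (∣x∣<∣y∣⇒x+y≢0 B (+ 3 * d) (ℕP.<-≤-trans (s≤s (ℕP.m≤n+m ∣ B ∣ ∣ A ∣))
        (subst (M ℕ.≤_) (sym (trans (ℤP.abs-* (+ 3) d) (cong (3 ℕ.*_) ∣d∣≡N)))
               (ℕP.≤-trans M≤N (ℕP.m≤n*m N 3)))))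
      where
      regroup : ∀ x t d → x + + 3 * t + + 3 * d ≡ x + + 3 * (t + d)
      regroup = solve-∀

  +[1+n]-1 : ∀ n → + suc n - + 1 ≡ + n
  +[1+n]-1 n = trans (cong (_- + 1) (ℤP.pos-+ 1 n)) (cancel (+ n))
    where
    cancel : ∀ x → + 1 + x - + 1 ≡ x
    cancel = solve-∀

  Val₂-s²+3t-shifted : ∀ {s t} k K m → Odd s → t ≡ + 3 + + 4 * k →
    Val₂ (s * s + + 3 * (t + (+ 2) ^ suc (suc K) * m)) 1
  Val₂-s²+3t-shifted {s} k K m s-odd refl =
    subst (λ x → Val₂ (s * s + + 3 * x) 1) (sym (regroup k ((+ 2) ^ K) m))
          (Val₂-s²+3[3+4k] (k + (+ 2) ^ K * m) s-odd)
    where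
    regroup : ∀ k P m → + 3 + + 4 * k + + 2 * (+ 2 * P) * m ≡ + 3 + + 4 * (k + P * m)
    regroup = solve-∀

  excess-vanishes : ∀ {s t e} n K m → Odd s → Odd t → ¬ (t ℤ.% + 4 ≡ 1 × (n % 6 ≡ 3 ⊎ n % 6 ≡ 4)) →
    Val₂ (s * s + + 3 * (t + (+ 2) ^ suc (suc K) * m)) (suc e) → excess e (n % 6) ≡ 0
  excess-vanishes {t = t} {e} n K m s-odd t-odd not-special b′-val with odd-mod4 t t-odd
  ... | inj₁ (t%4≡1 , _) = excess-other e (n % 6) (λ special → not-special (t%4≡1 , special))
  ... | inj₂ (_ , k , t≡) = subst (λ e → excess e (n % 6) ≡ 0)
    (sym (ℕP.suc-injective (Val₂-unique b′-val (Val₂-s²+3t-shifted k K m s-odd t≡)))) (excess-0 (n % 6))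

  ν₂-catalan-otherwise : ∀ {s t n C} → Odd s → Odd t → IsCatalan n C →
    ¬ (t ℤ.% + 4 ≡ 1 × (n % 6 ≡ 3 ⊎ n % 6 ≡ 4)) → ν₂ (eval C s t) ≡ fin (+ ζF (suc n) - + 1)
  ν₂-catalan-otherwise {s} {t} {n} {C} s-odd t-odd isCat not-special =
    trans (ν₂-Val₂ c-val) (cong fin (sym (trans (cong (λ z → + z - + 1) (sym 1+v≡ζ)) (+[1+n]-1 v))))
    where
    ζ = ζF (suc n)
    shift = shift-to-generic s (suc ζ) t-odd
    m = proj₁ shift
    t′ = t + (+ 2) ^ suc (suc ζ) * m
    t′-odd = proj₁ (proj₂ shift)
    b′-exists = Val₂-exists-even (odd+odd⇒even (odd-* s-odd s-odd) (odd-* (+ 1 , refl) t′-odd))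
                                 (proj₂ (proj₂ (proj₂ shift)))
    e = proj₁ b′-exists
    b′-val = proj₂ b′-exists
    catalan′ = ν₂-catalan-generic s-odd t′-odd (proj₁ (proj₂ (proj₂ shift))) b′-val n C isCat
    v = proj₁ catalan′
    1+v≡ζ : suc v ≡ ζ
    1+v≡ζ = trans (proj₂ (proj₂ catalan′)) (cong (ℕ._+ ζ) (excess-vanishes n ζ m s-odd t-odd not-special b′-val))
    c-val : Val₂ (eval C s t) v
    c-val = Val₂-eval-shift C 2 m
      (subst (λ k → Val₂ (eval C s (t + (+ 2) ^ k * m)) v)
             (trans (cong (λ z → suc (suc z)) (sym 1+v≡ζ)) (ℕP.+-comm 2 (suc v)))
             (proj₁ (proj₂ catalan′)))

  eval-luc6 : ∀ s t → eval (luc 6) s t ≡ (s * s + t) * (s * (s * s + + 3 * t))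
  eval-luc6 s t = trans (Evaluation.eval-luc s t 6) (trans (lucas-*3 s t 2)
    (cong (_*_ (s * s + t)) (trans (lucas-2 (s * s * s + + 3 * s * t) (t * t * t)) (expand s t))))
    where
    expand : ∀ s t → s * s * s + + 3 * s * t ≡ s * (s * s + + 3 * t)
    expand = solve-∀

  odd-1+4k : ∀ k → Odd (+ 1 + + 4 * k)
  odd-1+4k k = + 2 * k , regroup k
    where
    regroup : ∀ k → + 1 + + 4 * k ≡ + 2 * (+ 2 * k) + + 1
    regroup = solve-∀

  +v≡ζ+[2+e]-3 : ∀ v e ζ → suc v ≡ e ℕ.+ ζ → + v ≡ + ζ + + suc (suc e) + - + 3
  +v≡ζ+[2+e]-3 v e ζ 1+v≡ = begin
    + v                        ≡⟨ sym (+[1+n]-1 v) ⟩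
    + suc v - + 1              ≡⟨ cong (λ z → + z - + 1) 1+v≡ ⟩
    + (e ℕ.+ ζ) - + 1          ≡⟨ cong (_- + 1) (ℤP.pos-+ e ζ) ⟩
    + e + + ζ - + 1            ≡⟨ regroup (+ e) (+ ζ) ⟩
    + ζ + (+ 2 + + e) + - + 3  ≡⟨ cong (λ z → + ζ + z + - + 3) (sym (ℤP.pos-+ 2 e)) ⟩
    + ζ + + suc (suc e) + - + 3 ∎
    where
    open ≡-Reasoning
    regroup : ∀ e ζ → e + ζ - + 1 ≡ ζ + (+ 2 + e) + - + 3
    regroup = solve-∀

  ν₂-catalan-special : ∀ {s t n C} k → Odd s → t ≡ + 1 + + 4 * k → n % 6 ≡ 3 ⊎ n % 6 ≡ 4 →
    s * s + + 3 * t ≢ + 0 → IsCatalan n C →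
    ν₂ (eval C s t) ≡ (fin (+ ζF (suc n)) +∞ ν₂ (eval (luc 6) s t)) +∞ fin (- + 3)
  ν₂-catalan-special {s} {t} {n} {C} k s-odd refl special b≢0 isCat = begin
    ν₂ (eval C s t)
      ≡⟨ ν₂-Val₂ (proj₁ (proj₂ catalan)) ⟩
    fin (+ v)
      ≡⟨ cong fin (+v≡ζ+[2+e]-3 v e ζ 1+v≡) ⟩
    fin (+ ζ + + suc (suc e) + - + 3)
      ≡⟨ cong (λ x → (fin (+ ζ) +∞ x) +∞ fin (- + 3)) (sym (ν₂-Val₂ luc6-val)) ⟩
    (fin (+ ζ) +∞ ν₂ (eval (luc 6) s t)) +∞ fin (- + 3) ∎
    where
    open ≡-Reasoning
    ζ = ζF (suc n)
    a-val = Val₂-s²+[1+4k] k s-odd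
    b-exists = Val₂-exists-even (odd+odd⇒even (odd-* s-odd s-odd) (odd-* (+ 1 , refl) (odd-1+4k k))) b≢0
    e = proj₁ b-exists
    catalan = ν₂-catalan-generic s-odd (odd-1+4k k) (Val₂⇒≢0 a-val) (proj₂ b-exists) n C isCat
    v = proj₁ catalan
    1+v≡ : suc v ≡ e ℕ.+ ζ
    1+v≡ = trans (proj₂ (proj₂ catalan)) (cong (ℕ._+ ζ) (excess-special e special))
    luc6-val : Val₂ (eval (luc 6) s t) (suc (suc e))
    luc6-val = subst (λ x → Val₂ x (suc (suc e))) (sym (eval-luc6 s t))
                     (Val₂-* a-val (Val₂-* (Val₂-odd s-odd) (proj₂ b-exists)))

  shift-degenerate : ∀ {s t} k K → Odd s → t ≡ + 1 + + 4 * k → s * s + + 3 * t ≡ + 0 →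
    let t′ = t + (+ 2) ^ suc (suc K) in
    Odd t′ × Val₂ (s * s + t′) 1 × Val₂ (s * s + + 3 * t′) (suc (suc K))
  shift-degenerate {s} {t} k K s-odd refl b≡0 =
    subst Odd (sym t′≡) (odd-1+4k (k + (+ 2) ^ K)) ,
    subst (λ x → Val₂ (s * s + x) 1) (sym t′≡) (Val₂-s²+[1+4k] (k + (+ 2) ^ K) s-odd) ,
    val₂ (+ 3) (+ 1 , refl) (trans (regroup (s * s) t d) (trans (cong (_+ d * + 3) b≡0) (ℤP.+-identityˡ (d * + 3))))
    where
    d = (+ 2) ^ suc (suc K)
    t′≡ : t + d ≡ + 1 + + 4 * (k + (+ 2) ^ K)
    t′≡ = shift k ((+ 2) ^ K)
      where
      shift : ∀ k P → + 1 + + 4 * k + + 2 * (+ 2 * P) ≡ + 1 + + 4 * (k + P)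
      shift = solve-∀
    regroup : ∀ x t d → x + + 3 * (t + d) ≡ x + + 3 * t + d * + 3
    regroup = solve-∀

  catalan-vanishes : ∀ {s t n C} k → Odd s → t ≡ + 1 + + 4 * k → n % 6 ≡ 3 ⊎ n % 6 ≡ 4 →
    s * s + + 3 * t ≡ + 0 → IsCatalan n C → eval C s t ≡ + 0
  catalan-vanishes {s} {t} {n} {C} k s-odd t≡ special b≡0 isCat = divisible-by-all-2^k⇒0 (eval C s t) 2^K∣c
    where
    ζ = ζF (suc n)
    2^K∣c : ∀ K → ∃[ w ] eval C s t ≡ (+ 2) ^ K * w
    2^K∣c K = (+ 2) ^ ζ * o - + 4 * w , (begin
      eval C s t                               ≡⟨ solve-for-c (eval C s t) (eval C s (t + d)) (d * w) shift-eq ⟩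
      eval C s (t + d) - d * w                 ≡⟨ cong (_- d * w) (Val₂.z≡2^k*oddPart c′-val) ⟩
      (+ 2) ^ v′ * o - d * w                   ≡⟨ cong (λ j → (+ 2) ^ j * o - d * w) v′≡K+ζ ⟩
      (+ 2) ^ (K ℕ.+ ζ) * o - d * w            ≡⟨ cong (λ x → x * o - d * w) (ℤP.^-distribˡ-+-* (+ 2) K ζ) ⟩
      (+ 2) ^ K * (+ 2) ^ ζ * o - d * w        ≡⟨ factor ((+ 2) ^ K) ((+ 2) ^ ζ) o w ⟩
      (+ 2) ^ K * ((+ 2) ^ ζ * o - + 4 * w)    ∎)
      where
      open ≡-Reasoning
      d = (+ 2) ^ suc (suc K)
      solve-for-c : ∀ x y z → y ≡ x + z → x ≡ y - z
      solve-for-c x _ z refl = cancel x z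
        where
        cancel : ∀ x z → x ≡ x + z - z
        cancel = solve-∀
      factor : ∀ P Q o w → P * Q * o - + 2 * (+ 2 * P) * w ≡ P * (Q * o - + 4 * w)
      factor = solve-∀
      w = proj₁ (eval-shift C s t d)
      shift-eq = proj₂ (eval-shift C s t d)
      shifted = shift-degenerate k K s-odd t≡ b≡0
      catalan′ = ν₂-catalan-generic s-odd (proj₁ shifted) (Val₂⇒≢0 (proj₁ (proj₂ shifted))) (proj₂ (proj₂ shifted))
                                    n C isCat
      v′ = proj₁ catalan′
      c′-val = proj₁ (proj₂ catalan′)
      o = Val₂.oddPart c′-val
      v′≡K+ζ : v′ ≡ K ℕ.+ ζ
      v′≡K+ζ = ℕP.suc-injective (trans (proj₂ (proj₂ catalan′)) (cong (ℕ._+ ζ) (excess-special (suc K) special)))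

  ν₂-catalan-t≡1[4] : ∀ {s t n C} → Odd s → Odd t → IsCatalan n C → t ℤ.% + 4 ≡ 1 × (n % 6 ≡ 3 ⊎ n % 6 ≡ 4) →
    ν₂ (eval C s t) ≡ (fin (+ ζF (suc n)) +∞ ν₂ (eval (luc 6) s t)) +∞ fin (- + 3)
  ν₂-catalan-t≡1[4] {s} {t} {n} {C} s-odd t-odd isCat (t%4≡1 , special) with odd-mod4 t t-odd
  ... | inj₂ (t%4≡3 , _) with trans (sym t%4≡1) t%4≡3
  ...   | ()
  ν₂-catalan-t≡1[4] {s} {t} {n} {C} s-odd t-odd isCat (t%4≡1 , special) | inj₁ (_ , k , t≡)
    with s * s + + 3 * t ℤ.≟ + 0
  ... | no b≢0 = ν₂-catalan-special {n = n} {C = C} k s-odd t≡ special b≢0 isCat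
  ... | yes b≡0 = trans (cong ν₂ (catalan-vanishes {n = n} {C = C} k s-odd t≡ special b≡0 isCat))
    (sym (cong (λ x → (fin (+ ζF (suc n)) +∞ ν₂ x) +∞ fin (- + 3)) luc6≡0))
    where
    luc6≡0 : eval (luc 6) s t ≡ + 0
    luc6≡0 = trans (eval-luc6 s t) (trans (cong (λ x → (s * s + t) * (s * x)) b≡0) (annihilate (s * s + t) s))
      where
      annihilate : ∀ x y → x * (y * + 0) ≡ + 0
      annihilate = solve-∀

theorem6p3 : (s t : ℤ) → ¬ (+ 2 ∣ s) → ¬ (+ 2 ∣ t) → (n : ℕ) → (C : Poly) → IsCatalan n C →
    ((ℤ._%_ t (+ 4) ≡ 1 × (n % 6 ≡ 3 ⊎ n % 6 ≡ 4)) →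
      ν₂ (eval C s t) ≡ (fin (+ ζF (suc n)) +∞ ν₂ (eval (luc 6) s t)) +∞ fin (ℤ.- + 3))
    × (¬ (ℤ._%_ t (+ 4) ≡ 1 × (n % 6 ≡ 3 ⊎ n % 6 ≡ 4)) →
      ν₂ (eval C s t) ≡ fin (+ ζF (suc n) - + 1))
theorem6p3 s t 2∤s 2∤t n C isCat =
  ν₂-catalan-t≡1[4] {n = n} {C = C} s-odd t-odd isCat , ν₂-catalan-otherwise {n = n} {C = C} s-odd t-odd isCat
  where
  s-odd = ¬2∣⇒odd s 2∤s
  t-odd = ¬2∣⇒odd t 2∤t
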